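{- There is an absolute constant $c>0$ such that for every real $0<\alpha<1$ there exists an infinite sequence $\mathcal{A}$ of positive integers with $d^{*}(\mathcal{A})>\alpha$ such that, writing $\mathcal{B}=\mathcal{A}\cdot\mathcal{A}=\{b_1<b_2<\cdots\}$, we have $b_{n+1}-b_n\ge c\,\alpha^{ -3}$ for every $n$.
   Context: For an infinite set $\mathcal{A}$ of positive integers, the upper Banach density is $d^{*}(\mathcal{A})=\limsup_{|I|\to\infty}\frac{|\mathcal{A}\cap I|}{|I|}$, where $I$ runs through all intervals of integers. The product set $\mathcal{A}\cdot\mathcal{A}$ is the set of all products $a_ia_j$ with $a_i,a_j\in\mathcal{A}$, and $b_1<b_2<\cdots$ denotes its elements in increasing order.
   Formalization: The parameter α ranges over the rationals with $0<\alpha<1$ instead of the reals, and the absolute constant c is taken rational. -}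

module Defs where

open import Data.Bool using (Bool; true; false; T)
open import Data.Nat as ℕ using (ℕ; zero; suc)
open import Data.Integer using (+_)
open import Data.Rational using (ℚ; _/_; _*_; _<_; _≤_)
open import Data.Product using (Σ; _×_; ∃)
open import Relation.Nullary using (¬_)

NatSet : Set
NatSet = ℕ → Bool

_∈_ : ℕ → NatSet → Set
n ∈ A = T (A n)

ℕ→ℚ : ℕ → ℚ
ℕ→ℚ n = + n / 1

Positive : NatSet → Set
Positive A = ¬ (0 ∈ A)

Infinite : NatSet → Set
Infinite A = (N : ℕ) → ∃ λ n → N ℕ.≤ n × n ∈ A

count : NatSet → ℕ → ℕ → ℕ
count A m zero = 0
count A m (suc L) with A (m ℕ.+ L)
... | true  = suc (count A m L)
... | false = count A m L

-- d*(A) > α, unfolding the limsup: there is β > α such that for every N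
-- there is an interval I = [m, m+L) with |I| = L ≥ N and |A ∩ I| ≥ β |I|.
UpperBanachDensityGt : NatSet → ℚ → Set
UpperBanachDensityGt A α =
  ∃ λ (β : ℚ) → α < β ×
    ((N : ℕ) → ∃ λ (m : ℕ) → ∃ λ (L : ℕ) →
       N ℕ.≤ L × β * ℕ→ℚ L ≤ ℕ→ℚ (count A m L))

InProd : NatSet → ℕ → Set
InProd A b = ∃ λ a₁ → ∃ λ a₂ → a₁ ∈ A × a₂ ∈ A × b ≡' (a₁ ℕ.* a₂)
  where
  open import Relation.Binary.PropositionalEquality renaming (_≡_ to _≡'_)

Consecutive : NatSet → ℕ → ℕ → Set
Consecutive A b b' = InProd A b × InProd A b' × b ℕ.< b' ×
  ((x : ℕ) → b ℕ.< x → x ℕ.< b' → ¬ InProd A x)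

{-# OPTIONS --safe #-}
-- For α < 1/4 pick m ≈ 1/(4α). The set is the union over k of the blocks
-- {X k + σ j : j ≤ k}, where σ j = 2mj + (j² mod m) and the block origins
-- X k grow doubly exponentially. Each block has k + 1 elements in an interval
-- of length 2m(k + 1), so the upper Banach density is at least 1/(2m) > α.
-- A product with factors from blocks k ≤ l lies in [X k X l, 4 X k X l), so
-- products from different pairs of blocks are a factor two apart. For blocks
-- k < l, products are ordered by their first factor with gaps at least X l
-- minus an error of X k times the block length. Within one block, products whose
-- offset sums differ are X k apart, which exceeds the squared block length. If
-- the sums agree, then j₁ + j₂ = j₃ + j₄ and j₁² + j₂² ≡ j₃² + j₄² (mod m); with
-- factors j, j + U + V and j + U, j + V this means m ∣ 2UV, while the products
-- differ by at least m²UV ≥ m³/2. This gap is of order α⁻³. For α ≥ 1/4 the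
-- positive integers suffice.
module Submission where

open import Data.Nat using (ℕ; NonZero)

module Arithmetic where
  open import Data.Bool using (true; false)
  open import Data.Empty using (⊥-elim)
  open import Data.Nat
  open import Data.Nat.DivMod
  open import Data.Nat.Divisibility using (_∣_; divides)
  open import Data.Nat.Properties
  open import Data.Nat.Tactic.RingSolver using (solve)
  open import Data.List using (_∷_; [])
  open import Data.Product using (_×_; _,_)
  open import Data.Product.Relation.Binary.Lex.Strict using (×-Lex; ×-compare)
  open import Data.Product.Relation.Binary.Pointwise.NonDependent using (Pointwise)
  open import Data.Sum using (inj₁; inj₂)
  open import Relation.Binary.Core using (Rel)
  open import Relation.Binary.Definitions using (Trichotomous; tri<; tri≈; tri>)
  open import Relation.Binary.PropositionalEquality
  open import Function using (_∘_)
  open import Level using (0ℓ)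
  open import Defs using (NatSet; _∈_; count)

  mono-from-suc : (f : ℕ → ℕ) → (∀ n → f n ≤ f (suc n)) → ∀ {m n} → m ≤ n → f m ≤ f n
  mono-from-suc f step {n = zero}  z≤n = ≤-refl
  mono-from-suc f step {n = suc n} m≤1+n with m≤n⇒m<n∨m≡n m≤1+n
  ... | inj₁ m<1+n = ≤-trans (mono-from-suc f step (s≤s⁻¹ m<1+n)) (step n)
  ... | inj₂ refl  = ≤-refl

  quotient-< : ∀ n {a b x y} → a < b → x < n → n * a + x < n * b + y
  quotient-< n {a} {b} {x} {y} a<b x<n = begin-strict
    n * a + x  <⟨ +-monoʳ-< (n * a) x<n ⟩
    n * a + n  ≡⟨ trans (+-comm (n * a) n) (sym (*-suc n a)) ⟩
    n * suc a  ≤⟨ *-monoʳ-≤ n a<b ⟩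
    n * b      ≤⟨ m≤m+n (n * b) y ⟩
    n * b + y  ∎
    where open ≤-Reasoning

  quotient-unique : ∀ n {a b x y} → x < n → y < n → n * a + x ≡ n * b + y → a ≡ b
  quotient-unique n {a} {b} x<n y<n eq with <-cmp a b
  ... | tri< a<b _ _ = ⊥-elim (<-irrefl eq (quotient-< n a<b x<n))
  ... | tri≈ _ a≡b _ = a≡b
  ... | tri> _ _ b<a = ⊥-elim (<-irrefl (sym eq) (quotient-< n b<a y<n))

  %-shift⇒∣ : ∀ n .{{_ : NonZero n}} x d → (x + d) % n ≡ x % n → n ∣ d
  %-shift⇒∣ n x d eq = divides (q′ ∸ q) (begin
    d                                ≡⟨ m+n∸m≡n x d ⟨
    (x + d) ∸ x                      ≡⟨ cong₂ _∸_ (m≡m%n+[m/n]*n (x + d) n) (m≡m%n+[m/n]*n x n) ⟩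
    ((x + d) % n + q′ * n) ∸ (x % n + q * n)
                                     ≡⟨ cong (λ r → (r + q′ * n) ∸ (x % n + q * n)) eq ⟩
    (x % n + q′ * n) ∸ (x % n + q * n) ≡⟨ [m+n]∸[m+o]≡n∸o (x % n) (q′ * n) (q * n) ⟩
    q′ * n ∸ q * n                   ≡⟨ *-distribʳ-∸ n q′ q ⟨
    (q′ ∸ q) * n                     ∎)
    where
    open ≡-Reasoning
    q : ℕ
    q = x / n
    q′ : ℕ
    q′ = (x + d) / n

  %-sum-≡⇒∣ : ∀ n .{{_ : NonZero n}} {a b c e d} →
              a % n + b % n ≡ c % n + e % n → a + b ≡ c + e + d → n ∣ d
  %-sum-≡⇒∣ n {a} {b} {c} {e} {d} residues sums = %-shift⇒∣ n (c + e) d (begin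
    (c + e + d) % n      ≡⟨ cong (_% n) sums ⟨
    (a + b) % n          ≡⟨ %-distribˡ-+ a b n ⟩
    (a % n + b % n) % n  ≡⟨ cong (_% n) residues ⟩
    (c % n + e % n) % n  ≡⟨ %-distribˡ-+ c e n ⟨
    (c + e) % n          ∎)
    where open ≡-Reasoning

  *-spread : ∀ x a t w {b} → a + b ≡ (a + t) + (a + w) →
             (x + a) * (x + b) + t * w ≡ (x + (a + t)) * (x + (a + w))
  *-spread x a t w {b} sums = begin
    (x + a) * (x + b) + t * w            ≡⟨ cong (λ z → (x + a) * (x + z) + t * w) b≡ ⟩
    (x + a) * (x + (t + (a + w))) + t * w ≡⟨ solve (x ∷ a ∷ t ∷ w ∷ []) ⟩
    (x + (a + t)) * (x + (a + w))        ∎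
    where
    open ≡-Reasoning
    b≡ : b ≡ t + (a + w)
    b≡ = +-cancelˡ-≡ a b (t + (a + w)) (trans sums (+-assoc a t (a + w)))

  window-gap : ∀ {x ℓ g a b c d} → a ≤ ℓ → b ≤ ℓ → ℓ * ℓ + g ≤ x → a + b < c + d →
               (x + a) * (x + b) + g ≤ (x + c) * (x + d)
  window-gap {x} {ℓ} {g} {a} {b} {c} {d} a≤ℓ b≤ℓ fits a+b<c+d = begin
    (x + a) * (x + b) + g              ≡⟨ solve (x ∷ a ∷ b ∷ g ∷ []) ⟩
    x * x + x * (a + b) + (a * b + g)  ≤⟨ +-monoʳ-≤ (x * x + x * (a + b)) ab+g≤x ⟩
    x * x + x * (a + b) + x            ≡⟨ solve (x ∷ a ∷ b ∷ []) ⟩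
    x * x + x * suc (a + b)            ≤⟨ +-monoʳ-≤ (x * x) (*-monoʳ-≤ x a+b<c+d) ⟩
    x * x + x * (c + d)                ≤⟨ m≤m+n (x * x + x * (c + d)) (c * d) ⟩
    x * x + x * (c + d) + c * d        ≡⟨ solve (x ∷ c ∷ d ∷ []) ⟩
    (x + c) * (x + d)                  ∎
    where
    open ≤-Reasoning
    ab+g≤x : a * b + g ≤ x
    ab+g≤x = ≤-trans (+-monoˡ-≤ g (*-mono-≤ a≤ℓ b≤ℓ)) fits

  count-≤-suc : ∀ (A : NatSet) x n → count A x n ≤ count A x (suc n)
  count-≤-suc A x n with A (x + n)
  ... | true  = n≤1+n (count A x n)
  ... | false = ≤-refl

  count-mono : ∀ (A : NatSet) x {n n′} → n ≤ n′ → count A x n ≤ count A x n′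
  count-mono A x = mono-from-suc (count A x) (count-≤-suc A x)

  count-∈ : ∀ (A : NatSet) x n → (x + n) ∈ A → count A x (suc n) ≡ suc (count A x n)
  count-∈ A x n x+n∈A with A (x + n)
  ... | true  = refl
  ... | false = ⊥-elim x+n∈A

  count-increasing : ∀ (A : NatSet) x (f : ℕ → ℕ) → (∀ i → f i < f (suc i)) →
                     ∀ n → (∀ {i} → i ≤ n → (x + f i) ∈ A) → suc n ≤ count A x (suc (f n))
  count-increasing A x f f< zero hits =
    ≤-trans (s≤s z≤n) (≤-reflexive (sym (count-∈ A x (f zero) (hits z≤n))))
  count-increasing A x f f< (suc n) hits = begin
    suc (suc n)                         ≤⟨ s≤s (count-increasing A x f f< n (hits ∘ m≤n⇒m≤1+n)) ⟩
    suc (count A x (suc (f n)))         ≤⟨ s≤s (count-mono A x (f< n)) ⟩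
    suc (count A x (f (suc n)))         ≡⟨ count-∈ A x (f (suc n)) (hits ≤-refl) ⟨
    count A x (suc (f (suc n)))         ∎
    where open ≤-Reasoning

  _<ₗₑₓ_ : Rel (ℕ × ℕ) 0ℓ
  _<ₗₑₓ_ = ×-Lex _≡_ _<_ _<_

  _≤ₗₑₓ_ : Rel (ℕ × ℕ) 0ℓ
  _≤ₗₑₓ_ = ×-Lex _≡_ _<_ _≤_

  <ₗₑₓ-compare : Trichotomous (Pointwise _≡_ _≡_) _<ₗₑₓ_
  <ₗₑₓ-compare = ×-compare sym <-cmp <-cmp

  <ₗₑₓ⇒≤ₗₑₓ : ∀ {p q} → p <ₗₑₓ q → p ≤ₗₑₓ q
  <ₗₑₓ⇒≤ₗₑₓ (inj₁ lt)         = inj₁ lt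
  <ₗₑₓ⇒≤ₗₑₓ (inj₂ (eq , lt)) = inj₂ (eq , <⇒≤ lt)

  ≤ₗₑₓ⇒≤ : ∀ {k j k′ j′} → (k , j) ≤ₗₑₓ (k′ , j′) → k ≤ k′
  ≤ₗₑₓ⇒≤ (inj₁ k<k′)      = <⇒≤ k<k′
  ≤ₗₑₓ⇒≤ (inj₂ (refl , _)) = ≤-refl

module Construction (m : ℕ) {{_ : NonZero m}} where
  open import Data.Empty using (⊥-elim)
  open import Data.Nat
  open import Data.Nat.DivMod using (_%_; m%n<n)
  open import Data.Nat.Divisibility using (∣⇒≤)
  open import Data.Nat.Properties
  open import Data.Nat.Tactic.RingSolver using (solve; solve-∀)
  open import Data.List using (_∷_; [])
  open import Data.Product using (_×_; _,_; ∃; ∃₂; proj₁; proj₂)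
  open import Data.Sum using (_⊎_; inj₁; inj₂)
  open import Relation.Binary.Definitions using (tri<; tri≈; tri>)
  open import Relation.Binary.PropositionalEquality
  open import Relation.Nullary.Decidable using (Dec; ⌊_⌋; toWitness; fromWitness)
  open import Defs using (NatSet; _∈_; count; InProd; Positive; Infinite)
  open Arithmetic

  m³ : ℕ
  m³ = m * m * m

  σ : ℕ → ℕ
  σ j = 2 * m * j + j * j % m

  L : ℕ → ℕ
  L k = 2 * m * suc k

  X : ℕ → ℕ
  X zero    = L 0 * L 0 + m³
  X (suc k) = 8 * (X k * X k)

  elem : ℕ → ℕ → ℕ
  elem k j = X k + σ j

  0<m³ : 0 < m³
  0<m³ = >-nonZero⁻¹ m³ {{m*n≢0 (m * m) m {{m*n≢0 m m}}}}

  X-nonZero : ∀ k → NonZero (X k)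
  X-nonZero zero    = >-nonZero (<-≤-trans 0<m³ (m≤n+m m³ (L 0 * L 0)))
  X-nonZero (suc k) = m*n≢0 8 (X k * X k) {{_}} {{m*n≢0 (X k) (X k) {{X-nonZero k}} {{X-nonZero k}}}}

  L-suc : ∀ k → L (suc k) ≤ 2 * L k
  L-suc k = begin
    2 * m * (2 + k)      ≤⟨ *-monoʳ-≤ (2 * m) (+-monoʳ-≤ 2 (m≤n+m k k)) ⟩
    2 * m * (2 + (k + k)) ≡⟨ solve (m ∷ k ∷ []) ⟩
    2 * (2 * m * suc k)  ∎
    where open ≤-Reasoning

  block-fits : ∀ k → L k * L k + m³ ≤ X k
  block-fits zero    = ≤-refl
  block-fits (suc k) = begin
    L (suc k) * L (suc k) + m³      ≤⟨ +-mono-≤ (*-mono-≤ (L-suc k) (L-suc k)) (m≤n*m m³ 4) ⟩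
    2 * L k * (2 * L k) + 4 * m³   ≡⟨ regroup (L k) m³ ⟩
    4 * (L k * L k + m³)           ≤⟨ *-monoʳ-≤ 4 (block-fits k) ⟩
    4 * X k                        ≤⟨ *-mono-≤ (m≤m+n 4 4) (m≤m*n (X k) (X k) {{X-nonZero k}}) ⟩
    8 * (X k * X k)                ∎
    where
    open ≤-Reasoning
    regroup : ∀ a b → 2 * a * (2 * a) + 4 * b ≡ 4 * (a * a + b)
    regroup = solve-∀

  m³≤X : ∀ k → m³ ≤ X k
  m³≤X k = ≤-trans (m≤n+m m³ (L k * L k)) (block-fits k)

  k<L : ∀ k → k < L k
  k<L k = m≤n*m (suc k) (2 * m) {{m*n≢0 2 m}}

  L≤X : ∀ k → L k ≤ X k
  L≤X k = begin
    L k            ≤⟨ m≤m*n (L k) (L k) {{>-nonZero (<-≤-trans z<s (k<L k))}} ⟩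
    L k * L k      ≤⟨ m≤m+n (L k * L k) m³ ⟩
    L k * L k + m³ ≤⟨ block-fits k ⟩
    X k            ∎
    where open ≤-Reasoning

  X-mono : ∀ {k l} → k ≤ l → X k ≤ X l
  X-mono = mono-from-suc X X-step
    where
    X-step : ∀ k → X k ≤ X (suc k)
    X-step k = ≤-trans (m≤m*n (X k) (X k) {{X-nonZero k}}) (m≤n*m (X k * X k) 8)

  X-squares : ∀ {k l} → k < l → 8 * (X k * X k) ≤ X l
  X-squares = X-mono

  8X≤X : ∀ {k l} → k < l → 8 * X k ≤ X l
  8X≤X {k} k<l = ≤-trans (*-monoʳ-≤ 8 (m≤m*n (X k) (X k) {{X-nonZero k}})) (X-squares k<l)

  cross-fits : ∀ {k l} → k < l → 2 * X k * L l + m³ ≤ X l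
  cross-fits {k} {suc l} k<1+l = begin
    2 * X k * L (suc l) + m³              ≤⟨ +-mono-≤ (*-mono-≤ (*-monoʳ-≤ 2 (X-mono (s≤s⁻¹ k<1+l))) L′≤2X) m³≤4XX ⟩
    2 * X l * (2 * X l) + 4 * (X l * X l) ≡⟨ regroup (X l) ⟩
    8 * (X l * X l)                       ∎
    where
    open ≤-Reasoning
    L′≤2X : L (suc l) ≤ 2 * X l
    L′≤2X = ≤-trans (L-suc l) (*-monoʳ-≤ 2 (L≤X l))
    m³≤4XX : m³ ≤ 4 * (X l * X l)
    m³≤4XX = ≤-trans (m³≤X l) (≤-trans (m≤m*n (X l) (X l) {{X-nonZero l}}) (m≤n*m (X l * X l) 4))
    regroup : ∀ x → 2 * x * (2 * x) + 4 * (x * x) ≡ 8 * (x * x)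
    regroup = solve-∀

  σ-residue< : ∀ j → j * j % m < m
  σ-residue< j = m%n<n (j * j) m

  σ-step : ∀ j U → σ j + m * suc U < σ (suc j + U)
  σ-step j U = begin-strict
    2 * m * j + j * j % m + m * suc U  <⟨ +-monoˡ-< (m * suc U) (+-monoʳ-< (2 * m * j) (σ-residue< j)) ⟩
    2 * m * j + m + m * suc U          ≤⟨ +-monoˡ-≤ (m * suc U) (+-monoʳ-≤ (2 * m * j) (m≤m*n m (suc U))) ⟩
    2 * m * j + m * suc U + m * suc U  ≡⟨ solve (m ∷ j ∷ U ∷ []) ⟩
    2 * m * (suc j + U)                ≤⟨ m≤m+n (2 * m * (suc j + U)) ((suc j + U) * (suc j + U) % m) ⟩
    σ (suc j + U)                      ∎
    where open ≤-Reasoning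

  σ-strict : ∀ {j j′} → j < j′ → σ j < σ j′
  σ-strict {j} j<j′ with m≤n⇒∃[o]m+o≡n j<j′
  ... | U , refl = ≤-<-trans (m≤m+n (σ j) (m * suc U)) (σ-step j U)

  σ<L : ∀ {j k} → j ≤ k → σ j < L k
  σ<L {j} {k} j≤k = begin-strict
    2 * m * j + j * j % m  <⟨ +-monoʳ-< (2 * m * j) (σ-residue< j) ⟩
    2 * m * j + m          ≤⟨ +-monoʳ-≤ (2 * m * j) (m≤m+n m (m + 0)) ⟩
    2 * m * j + 2 * m      ≡⟨ trans (*-suc (2 * m) j) (+-comm (2 * m) (2 * m * j)) ⟨
    2 * m * suc j          ≤⟨ *-monoʳ-≤ (2 * m) (s≤s j≤k) ⟩
    L k                    ∎
    where open ≤-Reasoning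

  σ-sum-injective : ∀ {a b c d} → σ a + σ b ≡ σ c + σ d →
                    a + b ≡ c + d × a * a % m + b * b % m ≡ c * c % m + d * d % m
  σ-sum-injective {a} {b} {c} {d} eq = sums≡ , residues≡
    where
    regroup : ∀ n x y r s → n * x + r + (n * y + s) ≡ n * (x + y) + (r + s)
    regroup = solve-∀
    residues<2m : ∀ x y → x * x % m + y * y % m < 2 * m
    residues<2m x y = ≤-trans (+-mono-<-≤ (σ-residue< x) (<⇒≤ (σ-residue< y)))
                              (≤-reflexive (cong (m +_) (sym (+-identityʳ m))))
    eq′ : 2 * m * (a + b) + (a * a % m + b * b % m) ≡ 2 * m * (c + d) + (c * c % m + d * d % m)
    eq′ = trans (sym (regroup (2 * m) a b _ _)) (trans eq (regroup (2 * m) c d _ _))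
    sums≡ : a + b ≡ c + d
    sums≡ = quotient-unique (2 * m) (residues<2m a b) (residues<2m c d) eq′
    residues≡ : a * a % m + b * b % m ≡ c * c % m + d * d % m
    residues≡ = +-cancelˡ-≡ (2 * m * (c + d)) _ _ (trans (cong (λ s → 2 * m * s + (a * a % m + b * b % m)) (sym sums≡)) eq′)

  X≤elem : ∀ k j → X k ≤ elem k j
  X≤elem k j = m≤m+n (X k) (σ j)

  elem<X+L : ∀ {k j} → j ≤ k → elem k j < X k + L k
  elem<X+L {k} j≤k = +-monoʳ-< (X k) (σ<L j≤k)

  elem≤2X : ∀ {k j} → j ≤ k → elem k j ≤ 2 * X k
  elem≤2X {k} j≤k = ≤-trans (<⇒≤ (elem<X+L j≤k)) (+-monoʳ-≤ (X k) (≤-trans (L≤X k) (m≤m+n (X k) 0)))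

  -- Bounding k by n costs nothing (k < X k ≤ n) and makes membership decidable.
  InBlocks : ℕ → Set
  InBlocks n = ∃ λ k → k < suc n × ∃ λ j → j < suc k × n ≡ elem k j

  inBlocks? : ∀ n → Dec (InBlocks n)
  inBlocks? n = anyUpTo? (λ k → anyUpTo? (λ j → n ≟ elem k j) (suc k)) (suc n)

  𝒜 : NatSet
  𝒜 n = ⌊ inBlocks? n ⌋

  elem∈𝒜 : ∀ k {j} → j ≤ k → elem k j ∈ 𝒜
  elem∈𝒜 k {j} j≤k = fromWitness (k , s≤s k≤elem , j , s≤s j≤k , refl)
    where
    k≤elem : k ≤ elem k j
    k≤elem = ≤-trans (<⇒≤ (k<L k)) (≤-trans (L≤X k) (X≤elem k j))

  ∈𝒜⇒elem : ∀ {n} → n ∈ 𝒜 → ∃₂ λ k j → j ≤ k × n ≡ elem k j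
  ∈𝒜⇒elem n∈𝒜 with toWitness n∈𝒜
  ... | k , _ , j , s≤s j≤k , n≡ = k , j , j≤k , n≡

  𝒜-positive : Positive 𝒜
  𝒜-positive 0∈𝒜 with ∈𝒜⇒elem 0∈𝒜
  ... | k , j , _ , 0≡ = <⇒≢ (<-≤-trans (>-nonZero⁻¹ (X k) {{X-nonZero k}}) (X≤elem k j)) 0≡

  𝒜-infinite : Infinite 𝒜
  𝒜-infinite N = elem N 0 , ≤-trans (<⇒≤ (k<L N)) (≤-trans (L≤X N) (X≤elem N 0)) , elem∈𝒜 N z≤n

  block-count : ∀ k → suc k ≤ count 𝒜 (X k) (L k)
  block-count k = ≤-trans (count-increasing 𝒜 (X k) σ (λ i → σ-strict (n<1+n i)) k (elem∈𝒜 k))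
                          (count-mono 𝒜 (X k) (σ<L ≤-refl))

  Apart : ℕ → ℕ → Set
  Apart b b′ = b ≡ b′ ⊎ m³ ≤ 2 * ∣ b - b′ ∣

  apart-sym : ∀ {b b′} → Apart b b′ → Apart b′ b
  apart-sym (inj₁ b≡b′) = inj₁ (sym b≡b′)
  apart-sym {b} {b′} (inj₂ gap) = inj₂ (subst (λ d → m³ ≤ 2 * d) (∣-∣-comm b b′) gap)

  apart-+ : ∀ {b d b′} → b + d ≡ b′ → m³ ≤ 2 * d → Apart b b′
  apart-+ {b} {d} refl gap = inj₂ (subst (λ e → m³ ≤ 2 * e) (sym (∣m-m+n∣≡n b d)) gap)

  apart-≤ : ∀ {b b′} → b + m³ ≤ b′ → Apart b b′
  apart-≤ {b} {b′} le = apart-+ (m+[n∸m]≡n (m+n≤o⇒m≤o b le)) (≤-trans m³≤d (m≤m+n (b′ ∸ b) _))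
    where
    m³≤d : m³ ≤ b′ ∸ b
    m³≤d = m+n≤o⇒m≤o∸n m³ (≤-trans (≤-reflexive (+-comm m³ b)) le)

  apart⇒gap : ∀ {b b′} → b < b′ → Apart b b′ → m³ ≤ 2 * (b′ ∸ b)
  apart⇒gap b<b′ (inj₁ refl) = ⊥-elim (<-irrefl refl b<b′)
  apart⇒gap b<b′ (inj₂ gap)  = subst (λ d → m³ ≤ 2 * d) (m≤n⇒∣m-n∣≡n∸m (<⇒≤ b<b′)) gap

  σ-increment : ∀ j U → m * suc U ≤ σ (suc j + U) ∸ σ j
  σ-increment j U = m+n≤o⇒m≤o∸n (m * suc U) (≤-trans (≤-reflexive (+-comm (m * suc U) (σ j))) (<⇒≤ (σ-step j U)))

  spread-apart : ∀ x {j j₂ j₃ j₄} → j < j₃ → j₃ ≤ j₄ → σ j + σ j₂ ≡ σ j₃ + σ j₄ →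
                 Apart ((x + σ j) * (x + σ j₂)) ((x + σ j₃) * (x + σ j₄))
  spread-apart x {j} {j₂} j<j₃ j₃≤j₄ eq with m≤n⇒∃[o]m+o≡n j<j₃ | m≤n⇒∃[o]m+o≡n (<-≤-trans j<j₃ j₃≤j₄)
  ... | U , refl | V , refl = apart-+ product≡ m³≤2tw
    where
    t : ℕ
    t = σ (suc j + U) ∸ σ j
    w : ℕ
    w = σ (suc j + V) ∸ σ j
    σ+t≡ : σ j + t ≡ σ (suc j + U)
    σ+t≡ = m+[n∸m]≡n (<⇒≤ (σ-strict (s≤s (m≤m+n j U))))
    σ+w≡ : σ j + w ≡ σ (suc j + V)
    σ+w≡ = m+[n∸m]≡n (<⇒≤ (σ-strict (s≤s (m≤m+n j V))))
    product≡ : (x + σ j) * (x + σ j₂) + t * w ≡ (x + σ (suc j + U)) * (x + σ (suc j + V))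
    product≡ = trans (*-spread x (σ j) t w (trans eq (sym (cong₂ _+_ σ+t≡ σ+w≡))))
                     (cong₂ (λ p q → (x + p) * (x + q)) σ+t≡ σ+w≡)
    sums≡ : j + j₂ ≡ suc j + U + (suc j + V)
    sums≡ = proj₁ (σ-sum-injective eq)
    residues≡ : j * j % m + j₂ * j₂ % m ≡ (suc j + U) * (suc j + U) % m + (suc j + V) * (suc j + V) % m
    residues≡ = proj₂ (σ-sum-injective eq)
    j₂≡ : j₂ ≡ suc U + (suc j + V)
    j₂≡ = +-cancelˡ-≡ j j₂ (suc U + (suc j + V)) (trans sums≡ (solve (j ∷ U ∷ V ∷ [])))
    squares : j * j + j₂ * j₂ ≡ (suc j + U) * (suc j + U) + (suc j + V) * (suc j + V) + 2 * (suc U * suc V)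
    squares rewrite j₂≡ = solve (j ∷ U ∷ V ∷ [])
    m≤2UV : m ≤ 2 * (suc U * suc V)
    m≤2UV = ∣⇒≤ (%-sum-≡⇒∣ m residues≡ squares)
    m³≤2tw : m³ ≤ 2 * (t * w)
    m³≤2tw = begin
      m * m * m                          ≤⟨ *-monoʳ-≤ (m * m) m≤2UV ⟩
      m * m * (2 * (suc U * suc V))      ≡⟨ solve (m ∷ U ∷ V ∷ []) ⟩
      2 * ((m * suc U) * (m * suc V))    ≤⟨ *-monoʳ-≤ 2 (*-mono-≤ (σ-increment j U) (σ-increment j V)) ⟩
      2 * (t * w)                        ∎
      where open ≤-Reasoning

  balanced-apart : ∀ x {j₁ j₂ j₃ j₄} → j₁ ≤ j₂ → j₃ ≤ j₄ → σ j₁ + σ j₂ ≡ σ j₃ + σ j₄ →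
                   Apart ((x + σ j₁) * (x + σ j₂)) ((x + σ j₃) * (x + σ j₄))
  balanced-apart x {j₁} {j₂} {j₃} {j₄} j₁≤j₂ j₃≤j₄ eq with <-cmp j₁ j₃
  ... | tri< j₁<j₃ _ _ = spread-apart x j₁<j₃ j₃≤j₄ eq
  ... | tri≈ _ refl _  = inj₁ (cong (λ s → (x + σ j₁) * (x + s)) (+-cancelˡ-≡ (σ j₁) (σ j₂) (σ j₄) eq))
  ... | tri> _ _ j₃<j₁ = apart-sym (spread-apart x j₃<j₁ j₁≤j₂ (sym eq))

  same-block-apart : ∀ {k j₁ j₂ j₃ j₄} → j₁ ≤ k → j₂ ≤ k → j₃ ≤ k → j₄ ≤ k → j₁ ≤ j₂ → j₃ ≤ j₄ →
                     Apart (elem k j₁ * elem k j₂) (elem k j₃ * elem k j₄)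
  same-block-apart {k} {j₁} {j₂} {j₃} {j₄} h₁ h₂ h₃ h₄ j₁≤j₂ j₃≤j₄ with <-cmp (σ j₁ + σ j₂) (σ j₃ + σ j₄)
  ... | tri< lt _ _ = apart-≤ (window-gap (<⇒≤ (σ<L h₁)) (<⇒≤ (σ<L h₂)) (block-fits k) lt)
  ... | tri≈ _ eq _ = balanced-apart (X k) j₁≤j₂ j₃≤j₄ eq
  ... | tri> _ _ gt = apart-sym (apart-≤ (window-gap (<⇒≤ (σ<L h₃)) (<⇒≤ (σ<L h₄)) (block-fits k) gt))

  mixed-gap : ∀ {k l j₁ j₂ j₃ j₄} → k < l → j₁ ≤ k → j₂ ≤ l → (j₁ , j₂) <ₗₑₓ (j₃ , j₄) →
              elem k j₁ * elem l j₂ + m³ ≤ elem k j₃ * elem l j₄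
  mixed-gap {k} {l} {j₁} {j₂} {j₃} {j₄} k<l h₁ h₂ (inj₁ j₁<j₃) = begin
    a * elem l j₂ + m³          ≤⟨ +-monoˡ-≤ m³ (*-monoʳ-≤ a (<⇒≤ (elem<X+L h₂))) ⟩
    a * (X l + L l) + m³        ≡⟨ cong (_+ m³) (*-distribˡ-+ a (X l) (L l)) ⟩
    a * X l + a * L l + m³      ≡⟨ +-assoc (a * X l) (a * L l) m³ ⟩
    a * X l + (a * L l + m³)    ≤⟨ +-monoʳ-≤ (a * X l) aL+m³≤X ⟩
    a * X l + X l               ≡⟨ +-comm (a * X l) (X l) ⟩
    suc a * X l                 ≤⟨ *-mono-≤ (+-monoʳ-< (X k) (σ-strict j₁<j₃)) (X≤elem l j₄) ⟩
    elem k j₃ * elem l j₄       ∎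
    where
    open ≤-Reasoning
    a : ℕ
    a = elem k j₁
    aL+m³≤X : a * L l + m³ ≤ X l
    aL+m³≤X = ≤-trans (+-monoˡ-≤ m³ (*-monoˡ-≤ (L l) (elem≤2X h₁))) (cross-fits k<l)
  mixed-gap {k} {l} {j₁} {j₂} {_} {j₄} k<l h₁ h₂ (inj₂ (refl , j₂<j₄)) = begin
    a * elem l j₂ + m³          ≤⟨ +-monoʳ-≤ (a * elem l j₂) (≤-trans (m³≤X k) (X≤elem k j₁)) ⟩
    a * elem l j₂ + a           ≡⟨ trans (*-suc a (elem l j₂)) (+-comm a (a * elem l j₂)) ⟨
    a * suc (elem l j₂)         ≤⟨ *-monoʳ-≤ a (+-monoʳ-< (X l) (σ-strict j₂<j₄)) ⟩
    a * elem l j₄               ∎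
    where
    open ≤-Reasoning
    a : ℕ
    a = elem k j₁

  type-growth : ∀ {k₁ k₂ k₃ k₄} → k₁ ≤ k₂ → (k₂ , k₁) <ₗₑₓ (k₄ , k₃) → 8 * (X k₁ * X k₂) ≤ X k₃ * X k₄
  type-growth {k₁} {k₂} {k₃} {k₄} k₁≤k₂ (inj₁ k₂<k₄) = begin
    8 * (X k₁ * X k₂)   ≤⟨ *-monoʳ-≤ 8 (*-monoˡ-≤ (X k₂) (X-mono k₁≤k₂)) ⟩
    8 * (X k₂ * X k₂)   ≤⟨ X-squares k₂<k₄ ⟩
    X k₄                ≤⟨ m≤n*m (X k₄) (X k₃) {{X-nonZero k₃}} ⟩
    X k₃ * X k₄         ∎
    where open ≤-Reasoning
  type-growth {k₁} {k₂} {k₃} _ (inj₂ (refl , k₁<k₃)) = begin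
    8 * (X k₁ * X k₂)   ≡⟨ *-assoc 8 (X k₁) (X k₂) ⟨
    8 * X k₁ * X k₂     ≤⟨ *-monoˡ-≤ (X k₂) (8X≤X k₁<k₃) ⟩
    X k₃ * X k₂         ∎
    where open ≤-Reasoning

  type-gap : ∀ {k₁ j₁ k₂ j₂ k₃ j₃ k₄ j₄} → j₁ ≤ k₁ → j₂ ≤ k₂ → k₁ ≤ k₂ → (k₂ , k₁) <ₗₑₓ (k₄ , k₃) →
             elem k₁ j₁ * elem k₂ j₂ + m³ ≤ elem k₃ j₃ * elem k₄ j₄
  type-gap {k₁} {j₁} {k₂} {j₂} {k₃} {j₃} {k₄} {j₄} h₁ h₂ k₁≤k₂ lt = begin
    elem k₁ j₁ * elem k₂ j₂ + m³                ≤⟨ +-mono-≤ (*-mono-≤ (elem≤2X h₁) (elem≤2X h₂)) m³≤4XX ⟩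
    2 * X k₁ * (2 * X k₂) + 4 * (X k₁ * X k₂)  ≡⟨ regroup (X k₁) (X k₂) ⟩
    8 * (X k₁ * X k₂)                          ≤⟨ type-growth k₁≤k₂ lt ⟩
    X k₃ * X k₄                                ≤⟨ *-mono-≤ (X≤elem k₃ j₃) (X≤elem k₄ j₄) ⟩
    elem k₃ j₃ * elem k₄ j₄                    ∎
    where
    open ≤-Reasoning
    regroup : ∀ x y → 2 * x * (2 * y) + 4 * (x * y) ≡ 8 * (x * y)
    regroup = solve-∀
    m³≤4XX : m³ ≤ 4 * (X k₁ * X k₂)
    m³≤4XX = ≤-trans (m³≤X k₁) (≤-trans (m≤m*n (X k₁) (X k₂) {{X-nonZero k₂}}) (m≤n*m (X k₁ * X k₂) 4))

  record Factorisation (b : ℕ) : Set where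
    constructor factorisation
    field
      k₁ j₁ k₂ j₂ : ℕ
      j₁≤k₁ : j₁ ≤ k₁
      j₂≤k₂ : j₂ ≤ k₂
      ordered : (k₁ , j₁) ≤ₗₑₓ (k₂ , j₂)
      b≡ : b ≡ elem k₁ j₁ * elem k₂ j₂

  factorise : ∀ {b} → InProd 𝒜 b → Factorisation b
  factorise (a₁ , a₂ , a₁∈𝒜 , a₂∈𝒜 , refl) with ∈𝒜⇒elem a₁∈𝒜 | ∈𝒜⇒elem a₂∈𝒜
  ... | k₁ , j₁ , h₁ , refl | k₂ , j₂ , h₂ , refl with <ₗₑₓ-compare (k₁ , j₁) (k₂ , j₂)
  ...   | tri< lt _ _          = factorisation k₁ j₁ k₂ j₂ h₁ h₂ (<ₗₑₓ⇒≤ₗₑₓ lt) refl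
  ...   | tri≈ _ (refl , refl) _ = factorisation k₁ j₁ k₁ j₁ h₁ h₁ (inj₂ (refl , ≤-refl)) refl
  ...   | tri> _ _ gt          = factorisation k₂ j₂ k₁ j₁ h₂ h₁ (<ₗₑₓ⇒≤ₗₑₓ gt) (*-comm (elem k₁ j₁) (elem k₂ j₂))

  same-type-apart : ∀ {k l j₁ j₂ j₃ j₄} → j₁ ≤ k → j₂ ≤ l → j₃ ≤ k → j₄ ≤ l →
                    (k , j₁) ≤ₗₑₓ (l , j₂) → (k , j₃) ≤ₗₑₓ (l , j₄) →
                    Apart (elem k j₁ * elem l j₂) (elem k j₃ * elem l j₄)
  same-type-apart {j₁ = j₁} {j₂} {j₃} {j₄} h₁ h₂ h₃ h₄ (inj₁ k<l) (inj₁ _) with <ₗₑₓ-compare (j₁ , j₂) (j₃ , j₄)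
  ... | tri< lt _ _            = apart-≤ (mixed-gap k<l h₁ h₂ lt)
  ... | tri≈ _ (refl , refl) _ = inj₁ refl
  ... | tri> _ _ gt            = apart-sym (apart-≤ (mixed-gap k<l h₃ h₄ gt))
  same-type-apart _ _ _ _ (inj₁ k<l) (inj₂ (refl , _)) = ⊥-elim (<-irrefl refl k<l)
  same-type-apart _ _ _ _ (inj₂ (refl , _)) (inj₁ k<l) = ⊥-elim (<-irrefl refl k<l)
  same-type-apart h₁ h₂ h₃ h₄ (inj₂ (refl , j₁≤j₂)) (inj₂ (_ , j₃≤j₄)) = same-block-apart h₁ h₂ h₃ h₄ j₁≤j₂ j₃≤j₄

  factorisations-apart : ∀ {b b′} → Factorisation b → Factorisation b′ → Apart b b′
  factorisations-apart (factorisation k₁ j₁ k₂ j₂ h₁ h₂ o refl) (factorisation k₃ j₃ k₄ j₄ h₃ h₄ o′ refl)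
    with <ₗₑₓ-compare (k₂ , k₁) (k₄ , k₃)
  ... | tri< lt _ _            = apart-≤ (type-gap h₁ h₂ (≤ₗₑₓ⇒≤ o) lt)
  ... | tri≈ _ (refl , refl) _ = same-type-apart h₁ h₂ h₃ h₄ o o′
  ... | tri> _ _ gt            = apart-sym (apart-≤ (type-gap h₃ h₄ (≤ₗₑₓ⇒≤ o′) gt))

  product-gap : ∀ {b b′} → InProd 𝒜 b → InProd 𝒜 b′ → b < b′ → m³ ≤ 2 * (b′ ∸ b)
  product-gap b∈ b′∈ b<b′ = apart⇒gap b<b′ (factorisations-apart (factorise b∈) (factorise b′∈))

module RationalBounds where
  open import Data.Nat as ℕ using (suc)
  import Data.Nat.Properties as ℕ
  open import Data.Integer as ℤ using (+_; +≤+; +<+)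
  import Data.Integer.Properties as ℤ
  open import Data.Nat.Coprimality using (Coprime)
  open import Data.Rational as ℚ using (ℚ; mkℚ; toℚᵘ; _/_)
  open import Data.Rational.Properties using (toℚᵘ-cancel-≤; toℚᵘ-cancel-<; toℚᵘ-homo-*; toℚᵘ-fromℚᵘ)
  open import Data.Rational.Unnormalised as ℚᵘ using (ℚᵘ; mkℚᵘ; *≤*; *<*)
  import Data.Rational.Unnormalised.Properties as ℚᵘ
  open import Relation.Binary.PropositionalEquality
  open import Defs using (ℕ→ℚ)

  mkℚᵘ-≤ : ∀ {a b c d} → a ℕ.* suc d ℕ.≤ c ℕ.* suc b → mkℚᵘ (+ a) b ℚᵘ.≤ mkℚᵘ (+ c) d
  mkℚᵘ-≤ {a} {b} {c} {d} le = *≤* (subst₂ ℤ._≤_ (ℤ.pos-* a (suc d)) (ℤ.pos-* c (suc b)) (+≤+ le))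

  mkℚᵘ-< : ∀ {a b c d} → a ℕ.* suc d ℕ.< c ℕ.* suc b → mkℚᵘ (+ a) b ℚᵘ.< mkℚᵘ (+ c) d
  mkℚᵘ-< {a} {b} {c} {d} lt = *<* (subst₂ ℤ._<_ (ℤ.pos-* a (suc d)) (ℤ.pos-* c (suc b)) (+<+ lt))

  mkℚᵘ-* : ∀ a b c d → mkℚᵘ (+ a) b ℚᵘ.* mkℚᵘ (+ c) d ≡ mkℚᵘ (+ (a ℕ.* c)) (d ℕ.+ b ℕ.* suc d)
  mkℚᵘ-* a b c d = cong (λ n → mkℚᵘ n (d ℕ.+ b ℕ.* suc d)) (sym (ℤ.pos-* a c))

  toℚᵘ-ℕ→ℚ : ∀ n → toℚᵘ (ℕ→ℚ n) ℚᵘ.≃ mkℚᵘ (+ n) 0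
  toℚᵘ-ℕ→ℚ n = toℚᵘ-fromℚᵘ (mkℚᵘ (+ n) 0)

  1/128≤*cube : ∀ g p d .(c : Coprime p (suc d)) →
                suc d ℕ.* suc d ℕ.* suc d ℕ.≤ 128 ℕ.* (g ℕ.* (p ℕ.* p ℕ.* p)) →
                + 1 / 128 ℚ.≤ ℕ→ℚ g ℚ.* (mkℚ (+ p) d c ℚ.* mkℚ (+ p) d c ℚ.* mkℚ (+ p) d c)
  1/128≤*cube g p d c le = toℚᵘ-cancel-≤ (begin
    toℚᵘ (+ 1 / 128)                          ≃⟨ toℚᵘ-fromℚᵘ (mkℚᵘ (+ 1) 127) ⟩
    mkℚᵘ (+ 1) 127                             ≤⟨ mkℚᵘ-≤ le′ ⟩
    mkℚᵘ (+ (g ℕ.* (p ℕ.* p ℕ.* p))) d³         ≡⟨ products ⟨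
    mkℚᵘ (+ g) 0 ℚᵘ.* (αᵘ ℚᵘ.* αᵘ ℚᵘ.* αᵘ)     ≃⟨ homomorphic ⟨
    toℚᵘ (ℕ→ℚ g ℚ.* (α ℚ.* α ℚ.* α))           ∎)
    where
    open ℚᵘ.≤-Reasoning
    α : ℚ
    α = mkℚ (+ p) d c
    αᵘ : ℚᵘ
    αᵘ = mkℚᵘ (+ p) d
    homomorphic : toℚᵘ (ℕ→ℚ g ℚ.* (α ℚ.* α ℚ.* α)) ℚᵘ.≃ mkℚᵘ (+ g) 0 ℚᵘ.* (αᵘ ℚᵘ.* αᵘ ℚᵘ.* αᵘ)
    homomorphic = ℚᵘ.≃-trans (toℚᵘ-homo-* (ℕ→ℚ g) (α ℚ.* α ℚ.* α))
                    (ℚᵘ.*-cong (toℚᵘ-ℕ→ℚ g)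
                      (ℚᵘ.≃-trans (toℚᵘ-homo-* (α ℚ.* α) α) (ℚᵘ.*-congʳ (toℚᵘ-homo-* α α))))
    d² : ℕ
    d² = d ℕ.+ d ℕ.* suc d
    d³ : ℕ
    d³ = d ℕ.+ d² ℕ.* suc d
    products : mkℚᵘ (+ g) 0 ℚᵘ.* (αᵘ ℚᵘ.* αᵘ ℚᵘ.* αᵘ) ≡ mkℚᵘ (+ (g ℕ.* (p ℕ.* p ℕ.* p))) d³
    products = trans (cong (mkℚᵘ (+ g) 0 ℚᵘ.*_) (trans (cong (ℚᵘ._* αᵘ) (mkℚᵘ-* p d p d)) (mkℚᵘ-* (p ℕ.* p) d² p d)))
                     (trans (mkℚᵘ-* g 0 (p ℕ.* p ℕ.* p) d³) (cong (mkℚᵘ _) (ℕ.+-identityʳ d³)))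
    le′ : 1 ℕ.* (suc d ℕ.* suc d ℕ.* suc d) ℕ.≤ g ℕ.* (p ℕ.* p ℕ.* p) ℕ.* 128
    le′ = ℕ.≤-trans (ℕ.≤-reflexive (ℕ.*-identityˡ (suc d ℕ.* suc d ℕ.* suc d)))
                    (ℕ.≤-trans le (ℕ.≤-reflexive (ℕ.*-comm 128 (g ℕ.* (p ℕ.* p ℕ.* p)))))

  mkℚ<1/suc : ∀ p d e .(c : Coprime p (suc d)) → p ℕ.* suc e ℕ.< suc d → mkℚ (+ p) d c ℚ.< + 1 / suc e
  mkℚ<1/suc p d e c lt = toℚᵘ-cancel-< (begin-strict
    mkℚᵘ (+ p) d        <⟨ mkℚᵘ-< (ℕ.≤-trans lt (ℕ.≤-reflexive (sym (ℕ.*-identityˡ (suc d))))) ⟩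
    mkℚᵘ (+ 1) e        ≃⟨ toℚᵘ-fromℚᵘ (mkℚᵘ (+ 1) e) ⟨
    toℚᵘ (+ 1 / suc e)  ∎)
    where open ℚᵘ.≤-Reasoning

  1/suc*≤ : ∀ e ℓ n → ℓ ℕ.≤ n ℕ.* suc e → + 1 / suc e ℚ.* ℕ→ℚ ℓ ℚ.≤ ℕ→ℚ n
  1/suc*≤ e ℓ n le = toℚᵘ-cancel-≤ (begin
    toℚᵘ (+ 1 / suc e ℚ.* ℕ→ℚ ℓ)         ≃⟨ homomorphic ⟩
    mkℚᵘ (+ 1) e ℚᵘ.* mkℚᵘ (+ ℓ) 0      ≡⟨ mkℚᵘ-* 1 e ℓ 0 ⟩
    mkℚᵘ (+ (1 ℕ.* ℓ)) (0 ℕ.+ e ℕ.* 1)  ≤⟨ mkℚᵘ-≤ le′ ⟩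
    mkℚᵘ (+ n) 0                       ≃⟨ toℚᵘ-ℕ→ℚ n ⟨
    toℚᵘ (ℕ→ℚ n)                       ∎)
    where
    open ℚᵘ.≤-Reasoning
    homomorphic : toℚᵘ (+ 1 / suc e ℚ.* ℕ→ℚ ℓ) ℚᵘ.≃ mkℚᵘ (+ 1) e ℚᵘ.* mkℚᵘ (+ ℓ) 0
    homomorphic = ℚᵘ.≃-trans (toℚᵘ-homo-* (+ 1 / suc e) (ℕ→ℚ ℓ))
                             (ℚᵘ.*-cong (toℚᵘ-fromℚᵘ (mkℚᵘ (+ 1) e)) (toℚᵘ-ℕ→ℚ ℓ))
    le′ : 1 ℕ.* ℓ ℕ.* 1 ℕ.≤ n ℕ.* suc (e ℕ.* 1)
    le′ = subst₂ ℕ._≤_ (sym (trans (ℕ.*-identityʳ (1 ℕ.* ℓ)) (ℕ.*-identityˡ ℓ)))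
                       (cong (λ x → n ℕ.* suc x) (sym (ℕ.*-identityʳ e))) le

module DenseSets where
  open import Data.Bool using (true; false)
  open import Data.Integer using (+_; -[1+_]; +<+)
  open import Data.List using (_∷_; [])
  open import Data.Nat
  open import Data.Nat.Coprimality using (Coprime)
  open import Data.Nat.DivMod using (_%_; m%n<n; m≡m%n+[m/n]*n; m/n*n≤m; m≥n⇒m/n>0)
  import Data.Nat.DivMod as ℕ
  open import Data.Nat.Properties
  open import Data.Nat.Tactic.RingSolver using (solve; solve-∀)
  open import Data.Product using (∃; _×_; _,_)
  open import Data.Rational as ℚ using (ℚ; mkℚ; 0ℚ; 1ℚ)
  open import Data.Unit using (tt)
  open import Relation.Binary.PropositionalEquality
  open import Relation.Nullary using (yes; no)
  open import Defs
  open RationalBounds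

  1/128 : ℚ
  1/128 = + 1 ℚ./ 128

  0<1/128 : 0ℚ ℚ.< 1/128
  0<1/128 = ℚ.*<* (+<+ (s≤s z≤n))

  DenseWithSparseProducts : ℚ → ℚ → Set
  DenseWithSparseProducts c α = ∃ λ (A : NatSet) → Positive A × Infinite A × UpperBanachDensityGt A α ×
    ((b b′ : ℕ) → Consecutive A b b′ → c ℚ.≤ ℕ→ℚ (b′ ∸ b) ℚ.* (α ℚ.* α ℚ.* α))

  cube-bound : ∀ q p m g → q ≤ 4 * (p * m) → m * m * m ≤ 2 * g → q * q * q ≤ 128 * (g * (p * p * p))
  cube-bound q p m g q≤ m³≤ = begin
    q * q * q                                    ≤⟨ *-mono-≤ (*-mono-≤ q≤ q≤) q≤ ⟩
    4 * (p * m) * (4 * (p * m)) * (4 * (p * m))  ≡⟨ solve (p ∷ m ∷ []) ⟩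
    64 * (m * m * m) * (p * p * p)               ≤⟨ *-monoˡ-≤ (p * p * p) (*-monoʳ-≤ 64 m³≤) ⟩
    64 * (2 * g) * (p * p * p)                   ≡⟨ solve (g ∷ p ∷ []) ⟩
    128 * (g * (p * p * p))                      ∎
    where open ≤-Reasoning

  scale : ∀ n d .{{_ : NonZero n}} → 2 * n ≤ suc d → ∃ λ m → 0 < m × n * m < suc d × suc d ≤ 2 * n * m
  scale n d 2n≤q = d ℕ./ n , 0<m , s≤s nm≤d , q≤2nm
    where
    open ≤-Reasoning
    m : ℕ
    m = d ℕ./ n
    n≤d : n ≤ d
    n≤d = s≤s⁻¹ (≤-trans (m<m+n n (>-nonZero⁻¹ n)) (≤-trans (≤-reflexive (cong (_+_ n) (sym (+-identityʳ n)))) 2n≤q))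
    0<m : 0 < m
    0<m = m≥n⇒m/n>0 n≤d
    nm≤d : n * m ≤ d
    nm≤d = ≤-trans (≤-reflexive (*-comm n m)) (m/n*n≤m d n)
    regroup : ∀ m n → m * n + m * n ≡ 2 * n * m
    regroup = solve-∀
    q≤2nm : suc d ≤ 2 * n * m
    q≤2nm = begin
      suc d                ≡⟨ cong suc (m≡m%n+[m/n]*n d n) ⟩
      suc (d % n + m * n)  ≤⟨ +-monoˡ-≤ (m * n) (m%n<n d n) ⟩
      n + m * n            ≤⟨ +-monoˡ-≤ (m * n) (m≤n*m n m {{>-nonZero 0<m}}) ⟩
      m * n + m * n        ≡⟨ regroup m n ⟩
      2 * n * m            ∎

  positives : NatSet
  positives zero    = false
  positives (suc _) = true

  count-positives : ∀ ℓ → count positives 1 ℓ ≡ ℓ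
  count-positives zero    = refl
  count-positives (suc ℓ) = cong suc (count-positives ℓ)

  large-α : ∀ p d .(c : Coprime p (suc d)) → mkℚ (+ p) d c ℚ.< 1ℚ → suc d ≤ 4 * p →
            DenseWithSparseProducts 1/128 (mkℚ (+ p) d c)
  large-α p d c α<1 q≤4p = positives , (λ ()) , (λ N → suc N , n≤1+n N , tt) , density , gaps
    where
    density : UpperBanachDensityGt positives (mkℚ (+ p) d c)
    density = 1ℚ , α<1 , λ N → 1 , N , ≤-refl ,
      1/suc*≤ 0 N (count positives 1 N) (≤-reflexive (trans (sym (*-identityʳ N)) (cong (_* 1) (sym (count-positives N)))))
    gaps : ∀ b b′ → Consecutive positives b b′ → 1/128 ℚ.≤ ℕ→ℚ (b′ ∸ b) ℚ.* (mkℚ (+ p) d c ℚ.* mkℚ (+ p) d c ℚ.* mkℚ (+ p) d c)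
    gaps b b′ (_ , _ , b<b′ , _) = 1/128≤*cube (b′ ∸ b) p d c
      (cube-bound (suc d) p 1 (b′ ∸ b) (≤-trans q≤4p (≤-reflexive (cong (4 *_) (sym (*-identityʳ p)))))
                  (≤-trans (m<n⇒0<n∸m b<b′) (m≤m+n (b′ ∸ b) (b′ ∸ b + 0))))

  small-α : ∀ p d .{{_ : NonZero p}} .(c : Coprime p (suc d)) → 4 * p < suc d →
            DenseWithSparseProducts 1/128 (mkℚ (+ p) d c)
  small-α p d c 4p<q with scale (2 * p) d {{m*n≢0 2 p}} (≤-trans (≤-reflexive (sym (*-assoc 2 2 p))) (<⇒≤ 4p<q))
  ... | suc m′ , _ , 2pm<q , q≤4pm = 𝒜 , 𝒜-positive , 𝒜-infinite , density , gaps
    where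
    open Construction (suc m′)
    -- suc 2m-1 reduces to 2 * suc m′, so the density bound below is 1/(2m).
    2m-1 : ℕ
    2m-1 = pred (2 * suc m′)
    regroup₁ : ∀ p m → p * (2 * m) ≡ 2 * p * m
    regroup₁ = solve-∀
    regroup₂ : ∀ p m → 2 * (2 * p) * m ≡ 4 * (p * m)
    regroup₂ = solve-∀
    density : UpperBanachDensityGt 𝒜 (mkℚ (+ p) d c)
    density = + 1 ℚ./ suc 2m-1 , mkℚ<1/suc p d 2m-1 c (≤-trans (≤-reflexive (cong suc (regroup₁ p (suc m′)))) 2pm<q) ,
      λ N → X N , L N , <⇒≤ (k<L N) ,
        1/suc*≤ 2m-1 (L N) (count 𝒜 (X N) (L N)) (≤-trans (≤-reflexive (*-comm (2 * suc m′) (suc N))) (*-monoˡ-≤ (2 * suc m′) (block-count N)))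
    gaps : ∀ b b′ → Consecutive 𝒜 b b′ → 1/128 ℚ.≤ ℕ→ℚ (b′ ∸ b) ℚ.* (mkℚ (+ p) d c ℚ.* mkℚ (+ p) d c ℚ.* mkℚ (+ p) d c)
    gaps b b′ (b∈ , b′∈ , b<b′ , _) = 1/128≤*cube (b′ ∸ b) p d c
      (cube-bound (suc d) p (suc m′) (b′ ∸ b) (≤-trans q≤4pm (≤-reflexive (regroup₂ p (suc m′)))) (product-gap b∈ b′∈ b<b′))

  dense-with-sparse-products : ∀ α → 0ℚ ℚ.< α → α ℚ.< 1ℚ → DenseWithSparseProducts 1/128 α
  dense-with-sparse-products (mkℚ -[1+ _ ] _ _) (ℚ.*<* ()) _
  dense-with-sparse-products (mkℚ (+ zero) _ _) (ℚ.*<* (+<+ ())) _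
  dense-with-sparse-products (mkℚ (+ suc p) d c) _ α<1 with 4 * suc p <? suc d
  ... | yes 4p<q = small-α (suc p) d c 4p<q
  ... | no 4p≮q  = large-α (suc p) d c α<1 (≮⇒≥ 4p≮q)

open import Defs
open import Data.Nat as ℕ using (ℕ; _∸_)
open import Data.Rational using (ℚ; 0ℚ; 1ℚ; _*_; _<_; _≤_)
open import Data.Product using (Σ; _×_; ∃; _,_)
open DenseSets using (1/128; 0<1/128; dense-with-sparse-products)

theorem2 : ∃ λ (c : ℚ) → 0ℚ < c ×
    ((α : ℚ) → 0ℚ < α → α < 1ℚ →
    ∃ λ (A : NatSet) → Positive A × Infinite A × UpperBanachDensityGt A α ×
    ((b b' : ℕ) → Consecutive A b b' →
    c ≤ ℕ→ℚ (b' ∸ b) * (α * α * α)))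
theorem2 = 1/128 , 0<1/128 , dense-with-sparse-products
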